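{- Let $p$ and $q$ be terms in the language $\langle \vee,\wedge,{}^{*},0,1\rangle$ of QB-algebras. Then the identity $p\approx q$ holds in every flat QB-algebra if and only if $p\approx q$ holds in the algebra $\mathbf{F}_3$.
   Context: A quasi-lattice is an algebra $\langle L;\vee,\wedge\rangle$ such that for all $x,y,z$: $\vee,\wedge$ are commutative and associative; $x\vee(x\wedge y)=x\vee x$ and $x\wedge(x\vee y)=x\wedge x$; $x\vee(y\vee y)=x\vee y$ and $x\wedge(y\wedge y)=x\wedge y$; $x\vee x=x\wedge x$. It is distributive if $x\vee(y\wedge z)=(x\vee y)\wedge(x\vee z)$ and $x\wedge(y\vee z)=(x\wedge y)\vee(x\wedge z)$. A quasi-Boolean algebra (QB-algebra) is an algebra $\langle Q;\vee,\wedge,{}^{*},0,1\rangle$ of type $\langle 2,2,1,0,0\rangle$ such that $\langle Q;\vee,\wedge\rangle$ is a distributive quasi-lattice and for all $x$: $x\vee 1=1$, $x\wedge 0=0$, $x\vee x^{*}=1$, $x\wedge x^{*}=0$, $(x\wedge x)^{*}=x^{*}\vee x^{*}$, $x^{**}=x$. A QB-algebra is flat if it satisfies $1=0$. $\mathbf{F}_3$ is the flat QB-algebra with universe $\{0,c,d\}$, $1=0$, $x\vee y=x\wedge y=0$ for all $x,y$, and $0^{*}=0$, $c^{*}=d$, $d^{*}=c$. -}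

module Defs where

open import Level using (Level; suc; Setω)
open import Data.Nat using (ℕ)
open import Relation.Binary.PropositionalEquality using (_≡_)

data Term : Set where
  var  : ℕ → Term
  _∨ₜ_ : Term → Term → Term
  _∧ₜ_ : Term → Term → Term
  _*ₜ  : Term → Term
  0ₜ   : Term
  1ₜ   : Term

record QBAlgebra (a : Level) : Set (suc a) where
  infixr 6 _∨_
  infixr 7 _∧_
  field
    Carrier : Set a
    _∨_ : Carrier → Carrier → Carrier
    _∧_ : Carrier → Carrier → Carrier
    _* : Carrier → Carrier
    𝟎 : Carrier
    𝟏 : Carrier
    ∨-comm  : ∀ x y → x ∨ y ≡ y ∨ x
    ∧-comm  : ∀ x y → x ∧ y ≡ y ∧ x
    ∨-assoc : ∀ x y z → (x ∨ y) ∨ z ≡ x ∨ (y ∨ z)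
    ∧-assoc : ∀ x y z → (x ∧ y) ∧ z ≡ x ∧ (y ∧ z)
    ∨-absorb : ∀ x y → x ∨ (x ∧ y) ≡ x ∨ x
    ∧-absorb : ∀ x y → x ∧ (x ∨ y) ≡ x ∧ x
    ∨-idem-r : ∀ x y → x ∨ (y ∨ y) ≡ x ∨ y
    ∧-idem-r : ∀ x y → x ∧ (y ∧ y) ≡ x ∧ y
    ∨∧-self  : ∀ x → x ∨ x ≡ x ∧ x
    ∨-distrib-∧ : ∀ x y z → x ∨ (y ∧ z) ≡ (x ∨ y) ∧ (x ∨ z)
    ∧-distrib-∨ : ∀ x y z → x ∧ (y ∨ z) ≡ (x ∧ y) ∨ (x ∧ z)
    ∨-one  : ∀ x → x ∨ 𝟏 ≡ 𝟏
    ∧-zero : ∀ x → x ∧ 𝟎 ≡ 𝟎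
    ∨-compl : ∀ x → x ∨ (x *) ≡ 𝟏
    ∧-compl : ∀ x → x ∧ (x *) ≡ 𝟎
    *-∧-self : ∀ x → (x ∧ x) * ≡ (x *) ∨ (x *)
    *-invol : ∀ x → (x *) * ≡ x

  ⟦_⟧ : Term → (ℕ → Carrier) → Carrier
  ⟦ var i ⟧ ρ = ρ i
  ⟦ p ∨ₜ q ⟧ ρ = ⟦ p ⟧ ρ ∨ ⟦ q ⟧ ρ
  ⟦ p ∧ₜ q ⟧ ρ = ⟦ p ⟧ ρ ∧ ⟦ q ⟧ ρ
  ⟦ p *ₜ ⟧ ρ = (⟦ p ⟧ ρ) *
  ⟦ 0ₜ ⟧ ρ = 𝟎
  ⟦ 1ₜ ⟧ ρ = 𝟏

open QBAlgebra public using (Carrier; 𝟎; 𝟏; ⟦_⟧)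

Flat : ∀ {a} → QBAlgebra a → Set a
Flat A = 𝟏 A ≡ 𝟎 A

Holds : ∀ {a} → QBAlgebra a → Term → Term → Set a
Holds A p q = ∀ (ρ : ℕ → Carrier A) → ⟦ A ⟧ p ρ ≡ ⟦ A ⟧ q ρ

data F3 : Set where
  z c d : F3

F3-op : F3 → F3 → F3
F3-op _ _ = z

F3-star : F3 → F3
F3-star z = z
F3-star c = d
F3-star d = c

open import Relation.Binary.PropositionalEquality using (refl)

𝐅₃ : QBAlgebra Level.zero
𝐅₃ = record
  { Carrier = F3 ; _∨_ = F3-op ; _∧_ = F3-op ; _* = F3-star ; 𝟎 = z ; 𝟏 = z
  ; ∨-comm = λ _ _ → refl ; ∧-comm = λ _ _ → refl
  ; ∨-assoc = λ _ _ _ → refl ; ∧-assoc = λ _ _ _ → refl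
  ; ∨-absorb = λ _ _ → refl ; ∧-absorb = λ _ _ → refl
  ; ∨-idem-r = λ _ _ → refl ; ∧-idem-r = λ _ _ → refl
  ; ∨∧-self = λ _ → refl
  ; ∨-distrib-∧ = λ _ _ _ → refl ; ∧-distrib-∨ = λ _ _ _ → refl
  ; ∨-one = λ _ → refl ; ∧-zero = λ _ → refl
  ; ∨-compl = λ _ → refl ; ∧-compl = λ _ → refl
  ; *-∧-self = λ _ → refl
  ; *-invol = λ { z → refl ; c → refl ; d → refl }
  }

HoldsInAllFlat : Term → Term → Setω
HoldsInAllFlat p q = ∀ {a : Level} (A : QBAlgebra a) → Flat A → Holds A p q

record _⇔ω_ (P : Setω) (Q : Set) : Setω where
  field
    to   : P → Q
    from : Q → P

module Submission where

-- In a flat QB-algebra 1 = 0 forces x ∨ y = x ∧ y = 0 for all x, y, and 0* = 0, so every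
-- term collapses to 0, a variable x, or its complement x*. In 𝐅₃ these normal forms take
-- pairwise different values under suitable assignments (c for x, d for x*, 0 for other
-- variables), so an identity true in 𝐅₃ has equal normal forms on both sides, and hence
-- holds in every flat QB-algebra.

open import Defs hiding (Carrier; 𝟎; 𝟏; ⟦_⟧)
open import Level using (Level)
open import Data.Bool using (Bool; true; false; not; if_then_else_)
open import Data.Nat using (ℕ; _≟_)
open import Function using (const)
open import Relation.Nullary using (yes; no; does)
open import Relation.Nullary.Decidable using (dec-true; dec-false)
open import Relation.Binary.PropositionalEquality
  using (_≡_; _≢_; refl; sym; trans; cong; subst; module ≡-Reasoning)

data NormalForm : Set where
  𝟎ₙ  : NormalForm
  lit : (negated : Bool) → ℕ → NormalForm

complementₙ : NormalForm → NormalForm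
complementₙ 𝟎ₙ        = 𝟎ₙ
complementₙ (lit b i) = lit (not b) i

normalise : Term → NormalForm
normalise (var i)  = lit false i
normalise (_ ∨ₜ _) = 𝟎ₙ
normalise (_ ∧ₜ _) = 𝟎ₙ
normalise (p *ₜ)   = complementₙ (normalise p)
normalise 0ₜ       = 𝟎ₙ
normalise 1ₜ       = 𝟎ₙ

module QBProperties {a : Level} (A : QBAlgebra a) where
  open QBAlgebra A

  ⟦_⟧ₙ : NormalForm → (ℕ → Carrier) → Carrier
  ⟦ 𝟎ₙ ⟧ₙ          ρ = 𝟎
  ⟦ lit false i ⟧ₙ ρ = ρ i
  ⟦ lit true  i ⟧ₙ ρ = ρ i *

  ∨-self≡∨-𝟎 : ∀ x → x ∨ x ≡ x ∨ 𝟎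
  ∨-self≡∨-𝟎 x = trans (sym (∨-absorb x 𝟎)) (cong (x ∨_) (∧-zero x))

  module FlatProperties (flat : Flat A) where

    ∨-𝟎 : ∀ x → x ∨ 𝟎 ≡ 𝟎
    ∨-𝟎 x = subst (λ w → x ∨ w ≡ w) flat (∨-one x)

    ∨-self : ∀ x → x ∨ x ≡ 𝟎
    ∨-self x = trans (∨-self≡∨-𝟎 x) (∨-𝟎 x)

    ∨-collapse : ∀ x y → x ∨ y ≡ 𝟎
    ∨-collapse x y = begin
      x ∨ y        ≡⟨ ∨-idem-r x y ⟨
      x ∨ (y ∨ y)  ≡⟨ cong (x ∨_) (∨-self y) ⟩
      x ∨ 𝟎        ≡⟨ ∨-𝟎 x ⟩
      𝟎            ∎
      where open ≡-Reasoning

    ∧-collapse : ∀ x y → x ∧ y ≡ 𝟎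
    ∧-collapse x y = begin
      x ∧ y        ≡⟨ ∧-idem-r x y ⟨
      x ∧ (y ∧ y)  ≡⟨ cong (x ∧_) (trans (sym (∨∧-self y)) (∨-self y)) ⟩
      x ∧ 𝟎        ≡⟨ ∧-zero x ⟩
      𝟎            ∎
      where open ≡-Reasoning

    𝟎*≡𝟎 : 𝟎 * ≡ 𝟎
    𝟎*≡𝟎 = begin
      𝟎 *            ≡⟨ cong _* (∧-zero 𝟎) ⟨
      (𝟎 ∧ 𝟎) *      ≡⟨ *-∧-self 𝟎 ⟩
      𝟎 * ∨ 𝟎 *      ≡⟨ ∨-self (𝟎 *) ⟩
      𝟎              ∎
      where open ≡-Reasoning

    ⟦complementₙ⟧ : ∀ n ρ → ⟦ complementₙ n ⟧ₙ ρ ≡ ⟦ n ⟧ₙ ρ *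
    ⟦complementₙ⟧ 𝟎ₙ            ρ = sym 𝟎*≡𝟎
    ⟦complementₙ⟧ (lit false i) ρ = refl
    ⟦complementₙ⟧ (lit true  i) ρ = sym (*-invol (ρ i))

    ⟦⟧≡⟦normalise⟧ : ∀ p ρ → ⟦ p ⟧ ρ ≡ ⟦ normalise p ⟧ₙ ρ
    ⟦⟧≡⟦normalise⟧ (var i)  ρ = refl
    ⟦⟧≡⟦normalise⟧ (p ∨ₜ q) ρ = ∨-collapse _ _
    ⟦⟧≡⟦normalise⟧ (p ∧ₜ q) ρ = ∧-collapse _ _
    ⟦⟧≡⟦normalise⟧ (p *ₜ)   ρ =
      trans (cong _* (⟦⟧≡⟦normalise⟧ p ρ)) (sym (⟦complementₙ⟧ (normalise p) ρ))
    ⟦⟧≡⟦normalise⟧ 0ₜ       ρ = refl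
    ⟦⟧≡⟦normalise⟧ 1ₜ       ρ = flat

    normalise≡⇒Holds : ∀ p q → normalise p ≡ normalise q → Holds A p q
    normalise≡⇒Holds p q eq ρ = begin
      ⟦ p ⟧ ρ                ≡⟨ ⟦⟧≡⟦normalise⟧ p ρ ⟩
      ⟦ normalise p ⟧ₙ ρ     ≡⟨ cong (λ n → ⟦ n ⟧ₙ ρ) eq ⟩
      ⟦ normalise q ⟧ₙ ρ     ≡⟨ ⟦⟧≡⟦normalise⟧ q ρ ⟨
      ⟦ q ⟧ ρ                ∎
      where open ≡-Reasoning

open QBProperties 𝐅₃ using (⟦_⟧ₙ)
open QBProperties.FlatProperties 𝐅₃ refl using (⟦⟧≡⟦normalise⟧)

c-at : ℕ → ℕ → F3
c-at i k = if does (k ≟ i) then c else z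

c-at-self : ∀ i → c-at i i ≡ c
c-at-self i = cong (if_then c else z) (dec-true (i ≟ i) refl)

c-at-other : ∀ {i j} → i ≢ j → c-at i j ≡ z
c-at-other {i} {j} i≢j = cong (if_then c else z) (dec-false (j ≟ i) (λ j≡i → i≢j (sym j≡i)))

⟦lit⟧≢z : ∀ b i ρ → ρ i ≡ c → ⟦ lit b i ⟧ₙ ρ ≢ z
⟦lit⟧≢z false i ρ ρi≡c eq with () ← trans (sym ρi≡c) eq
⟦lit⟧≢z true  i ρ ρi≡c eq with () ← trans (sym (cong F3-star ρi≡c)) eq

⟦lit⟧≡z : ∀ b j ρ → ρ j ≡ z → ⟦ lit b j ⟧ₙ ρ ≡ z
⟦lit⟧≡z false j ρ ρj≡z = ρj≡z
⟦lit⟧≡z true  j ρ ρj≡z = cong F3-star ρj≡z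

𝐅₃-separates : ∀ m n → (∀ ρ → ⟦ m ⟧ₙ ρ ≡ ⟦ n ⟧ₙ ρ) → m ≡ n
𝐅₃-separates 𝟎ₙ 𝟎ₙ _ = refl
𝐅₃-separates 𝟎ₙ (lit b j) eq with () ← ⟦lit⟧≢z b j (const c) refl (sym (eq (const c)))
𝐅₃-separates (lit b i) 𝟎ₙ eq with () ← ⟦lit⟧≢z b i (const c) refl (eq (const c))
𝐅₃-separates (lit b i) (lit b′ j) eq with i ≟ j
... | no i≢j with () ← ⟦lit⟧≢z b i (c-at i) (c-at-self i)
                         (trans (eq (c-at i)) (⟦lit⟧≡z b′ j (c-at i) (c-at-other i≢j)))
𝐅₃-separates (lit false i) (lit false .i) eq | yes refl = refl
𝐅₃-separates (lit true  i) (lit true  .i) eq | yes refl = refl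
𝐅₃-separates (lit false i) (lit true  .i) eq | yes refl with () ← eq (const c)
𝐅₃-separates (lit true  i) (lit false .i) eq | yes refl with () ← eq (const c)

Holds-𝐅₃⇒normalise≡ : ∀ p q → Holds 𝐅₃ p q → normalise p ≡ normalise q
Holds-𝐅₃⇒normalise≡ p q holds = 𝐅₃-separates (normalise p) (normalise q) λ ρ →
  trans (sym (⟦⟧≡⟦normalise⟧ p ρ)) (trans (holds ρ) (⟦⟧≡⟦normalise⟧ q ρ))

theorem4p1 : (p q : Term) → HoldsInAllFlat p q ⇔ω Holds 𝐅₃ p q
theorem4p1 p q = record
  { to   = λ holds → holds 𝐅₃ refl
  ; from = λ holds A flat →
      QBProperties.FlatProperties.normalise≡⇒Holds A flat p q (Holds-𝐅₃⇒normalise≡ p q holds)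
  }
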